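{- Let $H$ be a graph, let $p\ge3$, and let $\mathcal{X}$ be the set of pairs $(i,j)$ of integers with $i,j\ge3$ and $p\in\{i,j\}$. (i) If $H$ is an induced subgraph of $D^p_k$ for some $k\ge0$, then $H$ covers every pair in $\mathcal{X}$. (ii) If $D^p_k$ is an induced subgraph of $H$ for some $k\ge0$, then $H$ covers no pair $(i,j)$ (with $i,j\ge 3$) outside $\mathcal{X}$.
   Context: Graphs are finite and simple. $P_k$: path on $k$ vertices; $C_r$: cycle on $r$ vertices; $+$: disjoint union. For $k\ge0$, $r\ge3$, $D^r_k$ is obtained from $P_k+C_r$ by adding an edge between a vertex of the cycle and an end-vertex of the path ($D^r_0=C_r$). For $i,j\ge3$, $k\ge1$, the butterfly $B_{i,j,k}$ is obtained from $C_i+C_j$ by choosing a vertex $x$ of $C_i$ and $y$ of $C_j$ and adding a path with $k$ edges between $x$ and $y$. A graph $H$ covers the pair $(i,j)$ ($i,j\ge3$) if $H$ is isomorphic to an induced subgraph of $B_{i,j,N}$ where $N=2|V(H)|+1$. -}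

module Defs where

open import Data.Nat using (ℕ; zero; suc; _+_; _*_; _∸_; _<_; _≟_)
open import Data.Fin using (Fin; toℕ)
open import Data.Bool using (if_then_else_)
open import Data.Product using (Σ; ∃; _×_)
open import Data.Sum using (_⊎_)
open import Data.Empty using (⊥)
open import Relation.Nullary using (¬_)
open import Relation.Nullary.Decidable using (⌊_⌋)
open import Relation.Binary.PropositionalEquality using (_≡_)
open import Function.Definitions using (Injective)
open import Function.Bundles using (_⇔_)

record Graph : Set₁ where
  field
    n      : ℕ
    Adj    : Fin n → Fin n → Set
    sym    : ∀ {u v} → Adj u v → Adj v u
    irrefl : ∀ {u} → ¬ Adj u u
open Graph public

-- A "raw" graph: vertex set Fin n and an adjacency relation (used for the
-- concrete graphs D^r_k and B_{i,j,k}, which are simple whenever r,i,j ≥ 3).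
record RawGraph : Set₁ where
  field
    size : ℕ
    E    : Fin size → Fin size → Set
open RawGraph public

toRaw : Graph → RawGraph
toRaw G = record { size = n G ; E = Adj G }

InducedIn : RawGraph → RawGraph → Set
InducedIn G K = Σ (Fin (size G) → Fin (size K)) λ f →
  Injective _≡_ _≡_ f × (∀ u v → E G u v ⇔ E K (f u) (f v))

-- Directed arcs on ℕ; adjacency is their symmetric closure.
-- Cycle of length r on vertices a, a+1, ..., a+r-1.
CycleArc : ℕ → ℕ → ℕ → ℕ → Set
CycleArc a r u v =
  (Σ ℕ λ t → suc t < r × u ≡ a + t × v ≡ a + suc t)
  ⊎ (u ≡ a × v ≡ a + (r ∸ 1))

PathArc : (ℕ → ℕ) → ℕ → ℕ → ℕ → Set
PathArc pos k u v = Σ ℕ λ t → t < k × u ≡ pos t × v ≡ pos (suc t)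

symClose : (ℕ → ℕ → Set) → ℕ → ℕ → Set
symClose R u v = R u v ⊎ R v u

onFin : (m : ℕ) → (ℕ → ℕ → Set) → RawGraph
onFin m R = record { size = m ; E = λ u v → symClose R (toℕ u) (toℕ v) }

-- D^r_k: cycle on 0..r-1, path vertices r..r+k-1, with edge 0 — r
-- (the path is the walk 0, r, r+1, ..., r+k-1 minus its first vertex).
Dpos : ℕ → ℕ → ℕ
Dpos r zero    = 0
Dpos r (suc t) = r + t

D : ℕ → ℕ → RawGraph
D r k = onFin (r + k) (λ u v → CycleArc 0 r u v ⊎ PathArc (Dpos r) k u v)

-- Butterfly B_{i,j,k}: C_i on 0..i-1, C_j on i..i+j-1, and a path with
-- k edges from x = 0 to y = i whose k-1 internal vertices are i+j, ..., i+j+k-2.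
Bpos : ℕ → ℕ → ℕ → ℕ → ℕ
Bpos i j k zero    = 0
Bpos i j k (suc t) = if ⌊ suc t ≟ k ⌋ then i else i + j + t

B : ℕ → ℕ → ℕ → RawGraph
B i j k = onFin (i + j + (k ∸ 1))
  (λ u v → CycleArc 0 i u v ⊎ CycleArc i j u v ⊎ PathArc (Bpos i j k) k u v)

Covers : Graph → ℕ → ℕ → Set
Covers H i j = InducedIn (toRaw H) (B i j (2 * n H + 1))

-- (i) Let G ⊆ D^p_k be induced and N = 2|G| + 1.  G is first compressed into
-- D^p_{N-1}: the path vertices it uses are squeezed towards the cycle, each
-- gap shrinking to a single vertex (Squeeze, Compression).  Then D^p_{N-1}
-- is placed into B_{i,j,N} along the cycle of length p ∈ {i, j} and the path
-- (Butterfly.left-placement / right-placement).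
--
-- (ii) If D^p_k ⊆ H ⊆ B_{i,j,N}, the p-cycle of D^p_k becomes a cycle of
-- B_{i,j,N} with p ≤ |H| < N - 1 (Tadpole.cycle-of).  A cycle through a
-- degree-two vertex contains both its neighbours (forced); so a cycle this
-- short avoids the path, stays inside C_i or C_j, and then is all of it
-- (Butterfly.short-cycle, cycle-in-cycle).  Hence p ∈ {i, j}.
module Submission where

open import Defs hiding (sym)
open import Data.Nat using (ℕ; zero; suc; pred; _+_; _*_; _∸_; _≤_; _<_; _≟_; _<?_; z≤n; s≤s; s≤s⁻¹)
open import Data.Nat.Properties
open import Data.Fin using (Fin; toℕ; fromℕ<)
import Data.Fin as Fin
import Data.Fin.Properties as Finₚ
open import Data.Bool using (Bool; true; false; if_then_else_; _∨_)
open import Data.Bool.Properties using (∨-zeroʳ)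
open import Relation.Binary.Definitions using (tri<; tri≈; tri>)
open import Data.Product using (Σ; ∃; _×_; _,_; proj₁; proj₂)
open import Data.Sum using (_⊎_; inj₁; inj₂) renaming (swap to ⊎-swap; map to ⊎-map)
open import Data.Empty using (⊥; ⊥-elim)
open import Data.Unit using (⊤)
open import Relation.Nullary using (¬_; Dec; yes; no; does)
open import Relation.Nullary.Decidable using (⌊_⌋)
open import Relation.Binary.PropositionalEquality
open import Function.Base using (_∘_)
open import Function.Bundles using (_⇔_; mk⇔; Equivalence)
open import Function.Definitions using (Injective)
import Function.Properties.Equivalence as ⇔
open import Data.Product.Function.NonDependent.Propositional using (_×-⇔_)
open import Data.Sum.Function.Propositional using (_⊎-⇔_)

⊎-swap-⇔ : ∀ {A B : Set} → (A ⊎ B) ⇔ (B ⊎ A)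
⊎-swap-⇔ = mk⇔ ⊎-swap ⊎-swap

induced-trans : ∀ {F G H} → InducedIn F G → InducedIn G H → InducedIn F H
induced-trans (f , f-inj , f-adj) (g , g-inj , g-adj) =
  g ∘ f , f-inj ∘ g-inj , λ u v → ⇔.trans (f-adj u v) (g-adj (f u) (f v))

induced-refl : ∀ {G} → InducedIn G G
induced-refl = (λ u → u) , (λ e → e) , λ u v → ⇔.refl

fromLabels : ∀ {G : RawGraph} {m R} (ψ : Fin (size G) → ℕ) →
  (∀ u → ψ u < m) → (∀ u v → ψ u ≡ ψ v → u ≡ v) →
  (∀ u v → E G u v ⇔ symClose R (ψ u) (ψ v)) → InducedIn G (onFin m R)
fromLabels {G} {m} {R} ψ bound inj adj = g , g-inj , g-adj
  where
  g : Fin (size G) → Fin m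
  g u = fromℕ< (bound u)
  toℕ-g : ∀ u → toℕ (g u) ≡ ψ u
  toℕ-g u = Finₚ.toℕ-fromℕ< (bound u)
  g-inj : Injective _≡_ _≡_ g
  g-inj {u} {v} e = inj u v (trans (sym (toℕ-g u)) (trans (cong toℕ e) (toℕ-g v)))
  g-adj : ∀ u v → E G u v ⇔ symClose R (toℕ (g u)) (toℕ (g v))
  g-adj u v rewrite toℕ-g u | toℕ-g v = adj u v

pigeonhole : ∀ {m n} → n < m → (f : ∀ x → x < m → ℕ) → (∀ x lt → f x lt < n) →
  (∀ x y lx ly → f x lx ≡ f y ly → x ≡ y) → ⊥
pigeonhole {m} {n} n<m f bound inj
  with Finₚ.pigeonhole n<m (λ z → fromℕ< (bound (toℕ z) (Finₚ.toℕ<n z)))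
... | a , b , a<b , same = <⇒≢ a<b (inj (toℕ a) (toℕ b) _ _ (begin
      f (toℕ a) _                          ≡⟨ Finₚ.toℕ-fromℕ< _ ⟨
      toℕ (fromℕ< (bound (toℕ a) _))       ≡⟨ cong toℕ same ⟩
      toℕ (fromℕ< (bound (toℕ b) _))       ≡⟨ Finₚ.toℕ-fromℕ< _ ⟩
      f (toℕ b) _                          ∎))
  where open ≡-Reasoning

module _ (P : ℕ → Set) {hi : ℕ}
  (up : ∀ x → suc x < hi → P x → P (suc x))
  (down : ∀ x → suc x < hi → P (suc x) → P x) where

  propagate : ∀ s → s < hi → P s → ∀ x → x < hi → P x
  propagate s s<hi Ps x x<hi = from-zero x x<hi (to-zero s s<hi Ps)
    where
    to-zero : ∀ s → s < hi → P s → P 0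
    to-zero zero    _  Ps = Ps
    to-zero (suc s) lt Ps = to-zero s (<-trans (n<1+n s) lt) (down s lt Ps)
    from-zero : ∀ x → x < hi → P 0 → P x
    from-zero zero    _  P0 = P0
    from-zero (suc x) lt P0 = up x lt (from-zero x (<-trans (n<1+n x) lt) P0)

cycle-window : ∀ {c r u v} → 1 ≤ r → symClose (CycleArc c r) u v →
  (c ≤ u × u < c + r) × (c ≤ v × v < c + r)
cycle-window {c} {r} 1≤r (inj₁ arc) = arc-window 1≤r arc
  where
  arc-window : ∀ {r u v} → 1 ≤ r → CycleArc c r u v → (c ≤ u × u < c + r) × (c ≤ v × v < c + r)
  arc-window _ (inj₁ (t , lt , refl , refl)) =
    (m≤m+n c t , +-monoʳ-< c (<-trans (n<1+n t) lt)) , (m≤m+n c (suc t) , +-monoʳ-< c lt)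
  arc-window {suc r} _ (inj₂ (refl , refl)) =
    (≤-refl , m<m+n c (s≤s z≤n)) , (m≤m+n c r , +-monoʳ-< c (n<1+n r))
cycle-window 1≤r (inj₂ arc) with cycle-window 1≤r (inj₁ arc)
... | wu , wv = wv , wu

cyc-succ : ℕ → ℕ → ℕ → ℕ
cyc-succ c r u = if ⌊ suc u ≟ c + r ⌋ then c else suc u

cyc-pred : ℕ → ℕ → ℕ → ℕ
cyc-pred c r u = if ⌊ u ≟ c ⌋ then c + (r ∸ 1) else pred u

cyc-succ-inner : ∀ c r u → suc u < c + r → cyc-succ c r u ≡ suc u
cyc-succ-inner c r u lt with suc u ≟ c + r
... | yes e = ⊥-elim (<⇒≢ lt e)
... | no _  = refl

cyc-pred-inner : ∀ c r u → c < u → cyc-pred c r u ≡ pred u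
cyc-pred-inner c r u lt with u ≟ c
... | yes e = ⊥-elim (<⇒≢ lt (sym e))
... | no _  = refl

cycle-nbr : ∀ {c r u w} → 1 ≤ r → symClose (CycleArc c r) u w →
  w ≡ cyc-succ c r u ⊎ w ≡ cyc-pred c r u
cycle-nbr {c} {r} _ (inj₁ (inj₁ (t , lt , refl , refl))) = inj₁ (begin
  c + suc t           ≡⟨ +-suc c t ⟩
  suc (c + t)         ≡⟨ cyc-succ-inner c r (c + t) (subst (_< c + r) (+-suc c t) (+-monoʳ-< c lt)) ⟨
  cyc-succ c r (c + t) ∎)
  where open ≡-Reasoning
cycle-nbr {c} _ (inj₁ (inj₂ (refl , refl))) with c ≟ c
... | yes _ = inj₂ refl
... | no ne = ⊥-elim (ne refl)
cycle-nbr {c} {r} _ (inj₂ (inj₁ (t , _ , refl , refl))) = inj₂ (begin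
  c + t                      ≡⟨ cong pred (+-suc c t) ⟨
  pred (c + suc t)           ≡⟨ cyc-pred-inner c r (c + suc t) (m<m+n c (s≤s z≤n)) ⟨
  cyc-pred c r (c + suc t)   ∎)
  where open ≡-Reasoning
cycle-nbr {c} {suc r} _ (inj₂ (inj₂ (refl , refl))) with suc (c + r) ≟ c + suc r
... | yes _ = inj₁ refl
... | no ne = ⊥-elim (ne (sym (+-suc c r)))

cycle-shift : ∀ c r a b → symClose (CycleArc c r) (c + a) (c + b) ⇔ symClose (CycleArc 0 r) a b
cycle-shift c r a b = mk⇔ (⊎-map unshift unshift) (⊎-map shift shift)
  where
  unshift : ∀ {a b} → CycleArc c r (c + a) (c + b) → CycleArc 0 r a b
  unshift (inj₁ (t , lt , e₁ , e₂)) = inj₁ (t , lt , +-cancelˡ-≡ c _ _ e₁ , +-cancelˡ-≡ c _ _ e₂)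
  unshift (inj₂ (e₁ , e₂)) =
    inj₂ (+-cancelˡ-≡ c _ _ (trans e₁ (sym (+-identityʳ c))) , +-cancelˡ-≡ c _ _ e₂)
  shift : ∀ {a b} → CycleArc 0 r a b → CycleArc c r (c + a) (c + b)
  shift (inj₁ (t , lt , refl , refl)) = inj₁ (t , lt , refl , refl)
  shift (inj₂ (refl , refl)) = inj₂ (+-identityʳ c , refl)

record Cycle (m : ℕ) (R : ℕ → ℕ → Set) (p : ℕ) : Set where
  field
    long     : 3 ≤ p
    vertex   : ℕ → ℕ
    bounded  : ∀ {a} → a < p → vertex a < m
    distinct : ∀ {a b} → a < p → b < p → vertex a ≡ vertex b → a ≡ b
    next     : ∀ {a} → suc a < p → symClose R (vertex a) (vertex (suc a))
    wrap     : symClose R (vertex 0) (vertex (p ∸ 1))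

  OnCycle : ℕ → Set
  OnCycle w = Σ ℕ λ a → a < p × vertex a ≡ w

  TwoNeighbours : ℕ → Set
  TwoNeighbours a = Σ ℕ λ b → Σ ℕ λ c →
    b < p × c < p × b ≢ c × symClose R (vertex a) (vertex b) × symClose R (vertex a) (vertex c)

two-neighbours : ∀ {m R p} (C : Cycle m R p) → ∀ a → a < p → Cycle.TwoNeighbours C a
two-neighbours {p = 0} C = ⊥-elim (≤⇒≯ (Cycle.long C) (s≤s z≤n))
two-neighbours {p = 1} C = ⊥-elim (≤⇒≯ (Cycle.long C) (s≤s (s≤s z≤n)))
two-neighbours {p = 2} C = ⊥-elim (≤⇒≯ (Cycle.long C) (s≤s (s≤s (s≤s z≤n))))
two-neighbours {R = R} {p = suc (suc (suc q))} C = nbrs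
  where
  open Cycle C
  nbrs : ∀ a → a < suc (suc (suc q)) → TwoNeighbours a
  nbrs zero _ = 1 , suc (suc q) , s≤s (s≤s z≤n) , n<1+n _ , (λ ()) , next (s≤s (s≤s z≤n)) , wrap
  nbrs (suc a) a<p with suc (suc a) <? suc (suc (suc q))
  ... | yes a+2<p = suc (suc a) , a , a+2<p , <-trans (n<1+n a) a<p ,
          (λ e → <⇒≢ (<-trans (n<1+n a) (n<1+n (suc a))) (sym e)) , next a+2<p , ⊎-swap (next a<p)
  ... | no a+2≮p = 0 , a , s≤s z≤n , <-trans (n<1+n a) a<p , (λ e → 0≢1+n (trans e a≡last)) ,
          subst (λ z → symClose R (vertex (suc z)) (vertex 0)) (sym a≡last) (⊎-swap wrap) ,
          ⊎-swap (next a<p)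
    where
    a≡last : a ≡ suc q
    a≡last = ≤-antisym (s≤s⁻¹ (s≤s⁻¹ a<p)) (s≤s⁻¹ (s≤s⁻¹ (≮⇒≥ a+2≮p)))

module _ {m R p} (C : Cycle m R p) where
  open Cycle C

  -- A cycle vertex v whose cycle-neighbours all lie in {A, B} forces A onto
  -- the cycle, since v has two distinct cycle-neighbours.
  forced : ∀ {v A B} → OnCycle v → (∀ w → symClose R v w → OnCycle w → w ≡ A ⊎ w ≡ B) → OnCycle A
  forced (a , a<p , refl) only with two-neighbours C a a<p
  ... | b , c , b<p , c<p , b≢c , ab , ac
    with only (vertex b) ab (b , b<p , refl) | only (vertex c) ac (c , c<p , refl)
  ... | inj₁ e | _       = b , b<p , e
  ... | inj₂ _ | inj₁ e  = c , c<p , e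
  ... | inj₂ e | inj₂ e' = ⊥-elim (b≢c (distinct b<p c<p (trans e (sym e'))))

  along : (Q : ℕ → Set) → Q (vertex 0) →
    (∀ {a} → suc a < p → Q (vertex a) → Q (vertex (suc a))) → ∀ a → a < p → Q (vertex a)
  along Q Q₀ step zero    _   = Q₀
  along Q Q₀ step (suc a) a<p = step a<p (along Q Q₀ step a (<-trans (n<1+n a) a<p))

  restrict : ∀ {S : ℕ → ℕ → Set} (Dom : ℕ → Set) → (∀ a → a < p → Dom (vertex a)) →
    (∀ {u v} → Dom u → Dom v → symClose R u v → symClose S u v) → Cycle m S p
  restrict Dom inDom transfer = record
    { long = long ; vertex = vertex ; bounded = bounded ; distinct = distinct
    ; next = λ {a} lt → transfer (inDom a (<-trans (n<1+n a) lt)) (inDom (suc a) lt) (next lt)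
    ; wrap = transfer (inDom 0 0<p) (inDom (p ∸ 1) (∸-monoʳ-< (s≤s z≤n) 0<p)) wrap }
    where
    0<p : 0 < p
    0<p = ≤-trans (s≤s z≤n) long

  block-on-cycle : ∀ c s → (∀ x → x < s → OnCycle (c + x)) → s ≤ p
  block-on-cycle c s on = ≮⇒≥ λ p<s →
    pigeonhole p<s (λ x lt → proj₁ (on x lt)) (λ x lt → proj₁ (proj₂ (on x lt)))
    (λ x y lx ly e → +-cancelˡ-≡ c _ _
      (trans (sym (proj₂ (proj₂ (on x lx)))) (trans (cong vertex e) (proj₂ (proj₂ (on y ly))))))

-- A cycle of C(c, r) staying in the window [c, c + r) has length exactly r:
-- it is not longer by pigeonhole, and it covers the whole window because a
-- window vertex is adjacent only to its two cyclic neighbours.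
cycle-in-cycle : ∀ {m c r p} (C : Cycle m (CycleArc c r) p) → 1 ≤ r →
  (∀ a → a < p → c ≤ Cycle.vertex C a × Cycle.vertex C a < c + r) → p ≡ r
cycle-in-cycle {c = c} {r} {p} C 1≤r window = ≤-antisym p≤r r≤p
  where
  open Cycle C

  at-offset : ∀ a → a < p → c + (vertex a ∸ c) ≡ vertex a
  at-offset a a<p = m+[n∸m]≡n (proj₁ (window a a<p))

  p≤r : p ≤ r
  p≤r = ≮⇒≥ λ r<p → pigeonhole r<p (λ a _ → vertex a ∸ c)
    (λ a a<p → +-cancelˡ-< c _ _ (subst (_< c + r) (sym (at-offset a a<p)) (proj₂ (window a a<p))))
    (λ a b a<p b<p e → distinct a<p b<p
      (trans (sym (at-offset a a<p)) (trans (cong (c +_) e) (at-offset b b<p))))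

  step-up : ∀ x → suc x < r → OnCycle (c + x) → OnCycle (c + suc x)
  step-up x lt on = subst OnCycle (sym (+-suc c x)) (forced C on (λ w adj _ → succ-or-pred adj))
    where
    succ-or-pred : ∀ {w} → symClose (CycleArc c r) (c + x) w →
      w ≡ suc (c + x) ⊎ w ≡ cyc-pred c r (c + x)
    succ-or-pred adj with cycle-nbr 1≤r adj
    ... | inj₁ e =
      inj₁ (trans e (cyc-succ-inner c r (c + x) (subst (_< c + r) (+-suc c x) (+-monoʳ-< c lt))))
    ... | inj₂ e = inj₂ e

  step-down : ∀ x → suc x < r → OnCycle (c + suc x) → OnCycle (c + x)
  step-down x lt on = forced C on (λ w adj _ → ⊎-swap (succ-or-pred adj))
    where
    succ-or-pred : ∀ {w} → symClose (CycleArc c r) (c + suc x) w →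
      w ≡ cyc-succ c r (c + suc x) ⊎ w ≡ c + x
    succ-or-pred adj with cycle-nbr 1≤r adj
    ... | inj₁ e = inj₁ e
    ... | inj₂ e = inj₂ (trans e (trans (cyc-pred-inner c r (c + suc x) (m<m+n c (s≤s z≤n)))
                                       (cong pred (+-suc c x))))

  0<p : 0 < p
  0<p = ≤-trans (s≤s z≤n) long

  covered : ∀ x → x < r → OnCycle (c + x)
  covered = propagate (λ x → OnCycle (c + x)) step-up step-down (vertex 0 ∸ c)
    (+-cancelˡ-< c _ _ (subst (_< c + r) (sym (at-offset 0 0<p)) (proj₂ (window 0 0<p))))
    (0 , 0<p , sym (at-offset 0 0<p))

  r≤p : r ≤ p
  r≤p = block-on-cycle C c r covered

module Tadpole (r K : ℕ) (1≤r : 1 ≤ r) where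

  Arc : ℕ → ℕ → Set
  Arc u v = CycleArc 0 r u v ⊎ PathArc (Dpos r) K u v

  Adjacent : ℕ → ℕ → Set
  Adjacent = symClose Arc

  data Edge (u v : ℕ) : Set where
    cycle    : symClose (CycleArc 0 r) u v → Edge u v
    path-fwd : ∀ t → t < K → u ≡ Dpos r t → v ≡ r + t → Edge u v
    path-bwd : ∀ t → t < K → v ≡ Dpos r t → u ≡ r + t → Edge u v

  edge : ∀ {u v} → Adjacent u v → Edge u v
  edge (inj₁ (inj₁ c))                  = cycle (inj₁ c)
  edge (inj₁ (inj₂ (t , lt , eu , ev))) = path-fwd t lt eu ev
  edge (inj₂ (inj₁ c))                  = cycle (inj₂ c)
  edge (inj₂ (inj₂ (t , lt , ev , eu))) = path-bwd t lt ev eu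

  path-far : ∀ {a} x → a < r → a ≡ r + x → ⊥
  path-far x a<r refl = <⇒≱ a<r (m≤m+n r x)

  path-nonzero : ∀ x → r + x ≢ 0
  path-nonzero x e = <⇒≢ (≤-trans 1≤r (m≤m+n r x)) (sym e)

  cycle-adj : ∀ {a b} → a < r → b < r → Adjacent a b ⇔ symClose (CycleArc 0 r) a b
  cycle-adj {a} {b} a<r b<r = mk⇔ to (⊎-map inj₁ inj₁)
    where
    to : Adjacent a b → symClose (CycleArc 0 r) a b
    to adj with edge adj
    ... | cycle c = c
    ... | path-fwd t _ _ e = ⊥-elim (path-far t b<r e)
    ... | path-bwd t _ _ e = ⊥-elim (path-far t a<r e)

  attach-adj : ∀ {a x} → a < r → x < K → Adjacent a (r + x) ⇔ (a ≡ 0 × x ≡ 0)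
  attach-adj {a} {x} a<r x<K = mk⇔ to from
    where
    to : Adjacent a (r + x) → a ≡ 0 × x ≡ 0
    to adj with edge adj
    ... | cycle c = ⊥-elim (path-far x (proj₂ (proj₂ (cycle-window 1≤r c))) refl)
    ... | path-fwd zero    _ e e' = e , +-cancelˡ-≡ r _ _ e'
    ... | path-fwd (suc t) _ e _  = ⊥-elim (path-far t a<r e)
    ... | path-bwd zero    _ e _  = ⊥-elim (path-nonzero x e)
    ... | path-bwd (suc t) _ _ e  = ⊥-elim (path-far (suc t) a<r e)
    from : a ≡ 0 × x ≡ 0 → Adjacent a (r + x)
    from (refl , refl) = inj₁ (inj₂ (0 , x<K , refl , refl))

  path-adj : ∀ {x y} → x < K → y < K → Adjacent (r + x) (r + y) ⇔ (y ≡ suc x ⊎ x ≡ suc y)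
  path-adj {x} {y} x<K y<K = mk⇔ to from
    where
    to : Adjacent (r + x) (r + y) → y ≡ suc x ⊎ x ≡ suc y
    to adj with edge adj
    ... | cycle c = ⊥-elim (path-far x (proj₂ (proj₁ (cycle-window 1≤r c))) refl)
    ... | path-fwd zero    _ e _  = ⊥-elim (path-nonzero x e)
    ... | path-fwd (suc t) _ e e' = inj₁ (trans (+-cancelˡ-≡ r _ _ e') (cong suc (sym (+-cancelˡ-≡ r _ _ e))))
    ... | path-bwd zero    _ e _  = ⊥-elim (path-nonzero y e)
    ... | path-bwd (suc t) _ e e' = inj₂ (trans (+-cancelˡ-≡ r _ _ e') (cong suc (sym (+-cancelˡ-≡ r _ _ e))))
    from : y ≡ suc x ⊎ x ≡ suc y → Adjacent (r + x) (r + y)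
    from (inj₁ refl) = inj₁ (inj₂ (suc x , y<K , refl , refl))
    from (inj₂ refl) = inj₂ (inj₂ (suc y , x<K , refl , refl))

  cycle-of : ∀ {m R} → 3 ≤ r → InducedIn (D r K) (onFin m R) → Cycle m R r
  cycle-of {m} {R} 3≤r (f , f-inj , f-adj) = record
    { long = 3≤r ; vertex = vertex ; bounded = λ _ → Finₚ.toℕ<n _
    ; distinct = λ {a} {b} a<r b<r e → trans (sym (toℕ-at a<r))
        (trans (cong toℕ (f-inj (Finₚ.toℕ-injective e))) (toℕ-at b<r))
    ; next = λ {a} lt → image (<-trans (n<1+n a) lt) lt (inj₁ (inj₁ (inj₁ (a , lt , refl , refl))))
    ; wrap = image 1≤r (∸-monoʳ-< (s≤s z≤n) 1≤r) (inj₁ (inj₁ (inj₂ (refl , refl)))) }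
    where
    -- The vertex of D^r_K with label a.
    at : ℕ → Fin (r + K)
    at a with a <? r + K
    ... | yes lt = fromℕ< lt
    ... | no _   = fromℕ< (≤-trans 1≤r (m≤m+n r K))
    toℕ-at : ∀ {a} → a < r → toℕ (at a) ≡ a
    toℕ-at {a} a<r with a <? r + K
    ... | yes lt = Finₚ.toℕ-fromℕ< lt
    ... | no ≮   = ⊥-elim (≮ (<-≤-trans a<r (m≤m+n r K)))
    vertex : ℕ → ℕ
    vertex a = toℕ (f (at a))
    image : ∀ {a b} → a < r → b < r → Adjacent a b → symClose R (vertex a) (vertex b)
    image {a} {b} a<r b<r adj = Equivalence.to (f-adj (at a) (at b))
      (subst₂ Adjacent (sym (toℕ-at a<r)) (sym (toℕ-at b<r)) adj)

-- A placement of D^r_k into the graph onFin m R: the cycle vertex a goes to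
-- κ a and the path vertex r + x goes to τ x, for the path indices x that are
-- Used; the images are distinct and realise exactly the adjacency tables of
-- D^r_k.
record Placement (r k : ℕ) (Used : ℕ → Set) (m : ℕ) (R : ℕ → ℕ → Set) : Set where
  field
    κ τ        : ℕ → ℕ
    κ-bound    : ∀ {a} → a < r → κ a < m
    τ-bound    : ∀ {x} → x < k → Used x → τ x < m
    κ-inj      : ∀ {a b} → a < r → b < r → κ a ≡ κ b → a ≡ b
    τ-inj      : ∀ {x y} → x < k → y < k → Used x → Used y → τ x ≡ τ y → x ≡ y
    apart      : ∀ {a x} → a < r → x < k → Used x → κ a ≢ τ x
    cycle-adj  : ∀ {a b} → a < r → b < r → symClose R (κ a) (κ b) ⇔ symClose (CycleArc 0 r) a b
    attach-adj : ∀ {a x} → a < r → x < k → Used x → symClose R (κ a) (τ x) ⇔ (a ≡ 0 × x ≡ 0)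
    path-adj   : ∀ {x y} → x < k → y < k → Used x → Used y →
                 symClose R (τ x) (τ y) ⇔ (y ≡ suc x ⊎ x ≡ suc y)

placement-embeds : ∀ {r k Used m R} {G : RawGraph} → 1 ≤ r → Placement r k Used m R →
  ((f , _) : InducedIn G (D r k)) → (∀ u x → toℕ (f u) ≡ r + x → Used x) → InducedIn G (onFin m R)
placement-embeds {r} {k} {Used} {m} {R} {G} 1≤r P (f , f-inj , f-adj) used =
  fromLabels {R = R} (λ u → image (site u)) (λ u → image-bound (site u))
    (λ u v e → f-inj (Finₚ.toℕ-injective (image-inj (site u) (site v) e)))
    (λ u v → ⇔.trans (f-adj u v) (image-adj (site u) (site v)))
  where
  open Placement P
  module T = Tadpole r k 1≤r

  data Site (ℓ : ℕ) : Set where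
    on-cycle : ℓ < r → Site ℓ
    on-path  : ∀ x → x < k → Used x → ℓ ≡ r + x → Site ℓ

  site : ∀ u → Site (toℕ (f u))
  site u with toℕ (f u) <? r
  ... | yes ℓ<r = on-cycle ℓ<r
  ... | no ℓ≮r  =
    on-path x (+-cancelˡ-< r _ _ (subst (_< r + k) ℓ≡r+x (Finₚ.toℕ<n (f u)))) (used u x ℓ≡r+x) ℓ≡r+x
    where
    x : ℕ
    x = toℕ (f u) ∸ r
    ℓ≡r+x : toℕ (f u) ≡ r + x
    ℓ≡r+x = sym (m+[n∸m]≡n (≮⇒≥ ℓ≮r))

  image : ∀ {ℓ} → Site ℓ → ℕ
  image {ℓ} (on-cycle _) = κ ℓ
  image (on-path x _ _ _) = τ x

  image-bound : ∀ {ℓ} (s : Site ℓ) → image s < m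
  image-bound (on-cycle ℓ<r)        = κ-bound ℓ<r
  image-bound (on-path _ x<k ux _)  = τ-bound x<k ux

  image-inj : ∀ {ℓ ℓ'} (s : Site ℓ) (s' : Site ℓ') → image s ≡ image s' → ℓ ≡ ℓ'
  image-inj (on-cycle ℓ<r) (on-cycle ℓ'<r) e = κ-inj ℓ<r ℓ'<r e
  image-inj (on-cycle ℓ<r) (on-path _ y<k uy _) e = ⊥-elim (apart ℓ<r y<k uy e)
  image-inj (on-path _ x<k ux _) (on-cycle ℓ'<r) e = ⊥-elim (apart ℓ'<r x<k ux (sym e))
  image-inj (on-path _ x<k ux refl) (on-path _ y<k uy refl) e = cong (r +_) (τ-inj x<k y<k ux uy e)

  image-adj : ∀ {ℓ ℓ'} (s : Site ℓ) (s' : Site ℓ') → T.Adjacent ℓ ℓ' ⇔ symClose R (image s) (image s')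
  image-adj (on-cycle ℓ<r) (on-cycle ℓ'<r) = ⇔.trans (T.cycle-adj ℓ<r ℓ'<r) (⇔.sym (cycle-adj ℓ<r ℓ'<r))
  image-adj (on-cycle ℓ<r) (on-path _ y<k uy refl) =
    ⇔.trans (T.attach-adj ℓ<r y<k) (⇔.sym (attach-adj ℓ<r y<k uy))
  image-adj (on-path _ x<k ux refl) (on-cycle ℓ'<r) =
    ⇔.trans ⊎-swap-⇔ (⇔.trans (T.attach-adj ℓ'<r x<k)
      (⇔.trans (⇔.sym (attach-adj ℓ'<r x<k ux)) ⊎-swap-⇔))
  image-adj (on-path _ x<k ux refl) (on-path _ y<k uy refl) =
    ⇔.trans (T.path-adj x<k y<k) (⇔.sym (path-adj x<k y<k ux uy))

-- Reflection x ↦ K - 1 - x of [0, K): it reverses consecutiveness and sends 0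
-- to K - 1.
mirror : ∀ {x K} → x < K → suc (K ∸ suc x) ≡ K ∸ x
mirror x<K = sym (+-∸-assoc 1 x<K)

mirror-end : ∀ {x K} → x < K → suc (K ∸ suc x) ≡ K ⇔ x ≡ 0
mirror-end {x} {K} x<K = mk⇔ to from
  where
  to : suc (K ∸ suc x) ≡ K → x ≡ 0
  to e = ∸-cancelˡ-≡ (<⇒≤ x<K) z≤n (trans (sym (mirror x<K)) e)
  from : x ≡ 0 → suc (K ∸ suc x) ≡ K
  from refl = mirror x<K

mirror-succ : ∀ {x y K} → x < K → y < K → K ∸ suc y ≡ suc (K ∸ suc x) ⇔ x ≡ suc y
mirror-succ {x} {y} {K} x<K y<K = mk⇔ to from
  where
  to : K ∸ suc y ≡ suc (K ∸ suc x) → x ≡ suc y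
  to e = sym (∸-cancelˡ-≡ y<K (<⇒≤ x<K) (trans e (mirror x<K)))
  from : x ≡ suc y → K ∸ suc y ≡ suc (K ∸ suc x)
  from refl = sym (mirror x<K)

-- The butterfly B_{i,j,K+1} = onFin (i + j + K) Arc: the cycles C(0, i) and
-- C(i, j) joined by the path pos 0 = 0, pos 1, ..., pos (K+1) = i whose
-- internal vertices pos (t+1) = i+j+t (t < K) are the labels above i + j.
module Butterfly (i j K : ℕ) (1≤i : 1 ≤ i) (1≤j : 1 ≤ j) where

  pos : ℕ → ℕ
  pos = Bpos i j (suc K)

  Arc : ℕ → ℕ → Set
  Arc u v = CycleArc 0 i u v ⊎ CycleArc i j u v ⊎ PathArc pos (suc K) u v

  Adjacent : ℕ → ℕ → Set
  Adjacent = symClose Arc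

  pos-internal : ∀ {t} → t < K → pos (suc t) ≡ i + j + t
  pos-internal {t} t<K with suc t ≟ suc K
  ... | yes e = ⊥-elim (<⇒≢ t<K (suc-injective e))
  ... | no _  = refl

  pos-end : pos (suc K) ≡ i
  pos-end with suc K ≟ suc K
  ... | yes _ = refl
  ... | no ne = ⊥-elim (ne refl)

  pos-suc : ∀ {t} → t < suc K → (t < K × pos (suc t) ≡ i + j + t) ⊎ (t ≡ K × pos (suc t) ≡ i)
  pos-suc {t} t≤K with m≤n⇒m<n∨m≡n (s≤s⁻¹ t≤K)
  ... | inj₁ t<K  = inj₁ (t<K , pos-internal t<K)
  ... | inj₂ refl = inj₂ (refl , pos-end)

  pos-pred : ∀ t → t < suc K → (t ≡ 0 × pos t ≡ 0) ⊎ (Σ ℕ λ s → t ≡ suc s × s < K × pos t ≡ i + j + s)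
  pos-pred zero    _  = inj₁ (refl , refl)
  pos-pred (suc s) lt = inj₂ (s , refl , s≤s⁻¹ lt , pos-internal (s≤s⁻¹ lt))

  i≤pos-suc : ∀ {t} → t < suc K → i ≤ pos (suc t)
  i≤pos-suc t≤K with pos-suc t≤K
  ... | inj₁ (_ , e) = subst (i ≤_) (sym e) (≤-trans (m≤m+n i j) (m≤m+n (i + j) _))
  ... | inj₂ (_ , e) = ≤-reflexive (sym e)

  data Edge (u v : ℕ) : Set where
    left     : symClose (CycleArc 0 i) u v → Edge u v
    right    : symClose (CycleArc i j) u v → Edge u v
    path-fwd : ∀ t → t < suc K → u ≡ pos t → v ≡ pos (suc t) → Edge u v
    path-bwd : ∀ t → t < suc K → v ≡ pos t → u ≡ pos (suc t) → Edge u v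

  edge : ∀ {u v} → Adjacent u v → Edge u v
  edge (inj₁ (inj₁ c))                         = left (inj₁ c)
  edge (inj₁ (inj₂ (inj₁ c)))                  = right (inj₁ c)
  edge (inj₁ (inj₂ (inj₂ (t , lt , eu , ev)))) = path-fwd t lt eu ev
  edge (inj₂ (inj₁ c))                         = left (inj₂ c)
  edge (inj₂ (inj₂ (inj₁ c)))                  = right (inj₂ c)
  edge (inj₂ (inj₂ (inj₂ (t , lt , ev , eu)))) = path-bwd t lt ev eu

  path-edge : ∀ t → t < suc K → Adjacent (pos t) (pos (suc t))
  path-edge t lt = inj₁ (inj₂ (inj₂ (t , lt , refl , refl)))

  internal-far : ∀ {u} t → u ≡ i + j + t → u < i + j → ⊥
  internal-far t refl lt = <⇒≱ lt (m≤m+n (i + j) t)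

  internal-nonzero : ∀ t → i + j + t ≢ 0
  internal-nonzero t e = <⇒≢ (≤-trans 1≤i (≤-trans (m≤m+n i j) (m≤m+n (i + j) t))) (sym e)

  internal-cancel : ∀ {s t} → i + j + s ≡ i + j + t → s ≡ t
  internal-cancel = +-cancelˡ-≡ (i + j) _ _

  left-adj : ∀ {a b} → a < i → b < i → Adjacent a b ⇔ symClose (CycleArc 0 i) a b
  left-adj {a} {b} a<i b<i = mk⇔ to from
    where
    to : Adjacent a b → symClose (CycleArc 0 i) a b
    to adj with edge adj
    ... | left c = c
    ... | right c = ⊥-elim (<⇒≱ a<i (proj₁ (proj₁ (cycle-window 1≤j c))))
    ... | path-fwd t lt _ refl = ⊥-elim (<⇒≱ b<i (i≤pos-suc lt))
    ... | path-bwd t lt _ refl = ⊥-elim (<⇒≱ a<i (i≤pos-suc lt))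
    from : symClose (CycleArc 0 i) a b → Adjacent a b
    from = ⊎-map inj₁ inj₁

  right-adj : ∀ {a b} → i ≤ a → a < i + j → i ≤ b → b < i + j →
    Adjacent a b ⇔ symClose (CycleArc i j) a b
  right-adj {a} {b} i≤a a<ij i≤b b<ij = mk⇔ to from
    where
    not-tail : ∀ {u} t → t < suc K → u ≡ pos t → i ≤ u → u < i + j → ⊥
    not-tail zero    _  refl i≤u _   = <⇒≱ 1≤i i≤u
    not-tail (suc t) lt e    _   u<ij = internal-far t (trans e (pos-internal (s≤s⁻¹ lt))) u<ij
    to : Adjacent a b → symClose (CycleArc i j) a b
    to adj with edge adj
    ... | left c = ⊥-elim (<⇒≱ (proj₂ (proj₁ (cycle-window 1≤i c))) i≤a)
    ... | right c = c
    ... | path-fwd t lt ea _ = ⊥-elim (not-tail t lt ea i≤a a<ij)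
    ... | path-bwd t lt eb _ = ⊥-elim (not-tail t lt eb i≤b b<ij)
    from : symClose (CycleArc i j) a b → Adjacent a b
    from = ⊎-map (inj₂ ∘ inj₁) (inj₂ ∘ inj₁)

  right-adj-shifted : ∀ {a b} → a < j → b < j → Adjacent (i + a) (i + b) ⇔ symClose (CycleArc 0 j) a b
  right-adj-shifted {a} {b} a<j b<j = ⇔.trans
    (right-adj (m≤m+n i a) (+-monoʳ-< i a<j) (m≤m+n i b) (+-monoʳ-< i b<j)) (cycle-shift i j a b)

  left-right-apart : 1 ≤ K → ∀ {a b} → a < i → i ≤ b → b < i + j → ¬ Adjacent a b
  left-right-apart 1≤K {a} {b} a<i i≤b b<ij adj with edge adj
  ... | left c                   = <⇒≱ (proj₂ (proj₂ (cycle-window 1≤i c))) i≤b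
  ... | right c                  = <⇒≱ a<i (proj₁ (proj₁ (cycle-window 1≤j c)))
  ... | path-fwd zero _ _ refl   = internal-far 0 (pos-internal 1≤K) b<ij
  ... | path-fwd (suc t) lt refl _ = <⇒≱ a<i (i≤pos-suc (<-trans (n<1+n t) lt))
  ... | path-bwd t lt _ refl     = <⇒≱ a<i (i≤pos-suc lt)

  internal-nbr : ∀ {t w} → t < K → Adjacent (i + j + t) w → w ≡ pos t ⊎ w ≡ pos (suc (suc t))
  internal-nbr {t} t<K adj with edge adj
  ... | left c  = ⊥-elim (internal-far t refl (<-trans (proj₂ (proj₁ (cycle-window 1≤i c))) (m<m+n i 1≤j)))
  ... | right c = ⊥-elim (internal-far t refl (proj₂ (proj₁ (cycle-window 1≤j c))))
  ... | path-fwd zero _ e _ = ⊥-elim (internal-nonzero t e)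
  ... | path-fwd (suc s) lt e ew =
          inj₂ (trans ew (cong (pos ∘ suc ∘ suc) (sym (internal-cancel (trans e (pos-internal (s≤s⁻¹ lt)))))))
  ... | path-bwd s lt ew e with pos-suc lt
  ...   | inj₁ (_ , e') = inj₁ (trans ew (cong pos (internal-cancel (trans (sym e') (sym e)))))
  ...   | inj₂ (_ , e') = ⊥-elim (internal-far t (sym (trans e e')) (m<m+n i 1≤j))

  left-path-adj : ∀ {a t} → a < i → t < K → Adjacent a (i + j + t) ⇔ (a ≡ 0 × t ≡ 0)
  left-path-adj {a} {t} a<i t<K = mk⇔ to from
    where
    to : Adjacent a (i + j + t) → a ≡ 0 × t ≡ 0
    to adj with internal-nbr t<K (⊎-swap adj)
    to adj | inj₁ e with pos-pred t (<-trans t<K (n<1+n K))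
    ...   | inj₁ (t≡0 , e') = trans e e' , t≡0
    ...   | inj₂ (s , _ , _ , e') = ⊥-elim (internal-far s (trans e e') (<-trans a<i (m<m+n i 1≤j)))
    to adj | inj₂ e = ⊥-elim (<⇒≱ a<i (subst (i ≤_) (sym e) (i≤pos-suc (s≤s t<K))))
    from : a ≡ 0 × t ≡ 0 → Adjacent a (i + j + t)
    from (refl , refl) = subst (Adjacent 0) (pos-internal t<K) (path-edge 0 (s≤s z≤n))

  right-path-adj : ∀ {a t} → a < j → t < K → Adjacent (i + a) (i + j + t) ⇔ (a ≡ 0 × suc t ≡ K)
  right-path-adj {a} {t} a<j t<K = mk⇔ to from
    where
    to : Adjacent (i + a) (i + j + t) → a ≡ 0 × suc t ≡ K
    to adj with internal-nbr t<K (⊎-swap adj)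
    to adj | inj₁ e with pos-pred t (<-trans t<K (n<1+n K))
    ...   | inj₁ (_ , e') = ⊥-elim (<⇒≢ (≤-trans 1≤i (m≤m+n i a)) (sym (trans e e')))
    ...   | inj₂ (s , _ , _ , e') = ⊥-elim (internal-far s (trans e e') (+-monoʳ-< i a<j))
    to adj | inj₂ e with pos-suc (s≤s t<K)
    ...   | inj₁ (_ , e') = ⊥-elim (internal-far (suc t) (trans e e') (+-monoʳ-< i a<j))
    ...   | inj₂ (e₁ , e') = +-cancelˡ-≡ i _ _ (trans (trans e e') (sym (+-identityʳ i))) , e₁
    from : a ≡ 0 × suc t ≡ K → Adjacent (i + a) (i + j + t)
    from (refl , refl) = subst₂ Adjacent (trans pos-end (sym (+-identityʳ i))) (pos-internal t<K)
      (⊎-swap (path-edge (suc t) (n<1+n _)))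

  path-path-adj : ∀ {t t'} → t < K → t' < K →
    Adjacent (i + j + t) (i + j + t') ⇔ (t' ≡ suc t ⊎ t ≡ suc t')
  path-path-adj {t} {t'} t<K t'<K = mk⇔ to from
    where
    to : Adjacent (i + j + t) (i + j + t') → t' ≡ suc t ⊎ t ≡ suc t'
    to adj with internal-nbr t<K adj
    to adj | inj₁ e with pos-pred t (<-trans t<K (n<1+n K))
    ...   | inj₁ (_ , e') = ⊥-elim (internal-nonzero t' (trans e e'))
    ...   | inj₂ (s , t≡s+1 , _ , e') = inj₂ (trans t≡s+1 (cong suc (sym (internal-cancel (trans e e')))))
    to adj | inj₂ e with pos-suc (s≤s t<K)
    ...   | inj₁ (_ , e') = inj₁ (internal-cancel (trans e e'))
    ...   | inj₂ (_ , e') = ⊥-elim (internal-far t' (sym (trans e e')) (m<m+n i 1≤j))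
    from : t' ≡ suc t ⊎ t ≡ suc t' → Adjacent (i + j + t) (i + j + t')
    from (inj₁ refl) =
      subst₂ Adjacent (pos-internal t<K) (pos-internal t'<K) (path-edge (suc t) (<-trans t'<K (n<1+n K)))
    from (inj₂ refl) = ⊎-swap
      (subst₂ Adjacent (pos-internal t'<K) (pos-internal t<K) (path-edge (suc t') (<-trans t<K (n<1+n K))))

  -- An internal vertex on it would drag, one neighbour at a time,
  -- all K internal vertices onto the cycle; so the cycle lives below i + j,
  -- where it cannot cross between the two cycles and hence runs inside one.
  module ShortCycle {p} (C : Cycle (i + j + K) Arc p) (p<K : p < K) where
    open Cycle C

    1≤K : 1 ≤ K
    1≤K = ≤-trans (s≤s z≤n) p<K

    path-on-cycle : ∀ s → s < K → OnCycle (i + j + s) → ∀ t → t < K → OnCycle (i + j + t)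
    path-on-cycle = propagate (λ t → OnCycle (i + j + t)) step-up step-down
      where
      step-up : ∀ t → suc t < K → OnCycle (i + j + t) → OnCycle (i + j + suc t)
      step-up t lt on = forced C on λ w adj _ →
        ⊎-swap (⊎-map (λ e → e) (λ e → trans e (pos-internal lt)) (internal-nbr (<-trans (n<1+n t) lt) adj))
      step-down : ∀ t → suc t < K → OnCycle (i + j + suc t) → OnCycle (i + j + t)
      step-down t lt on = forced C on λ w adj _ →
        ⊎-map (λ e → trans e (pos-internal (<-trans (n<1+n t) lt))) (λ e → e) (internal-nbr lt adj)

    below-path : ∀ a → a < p → vertex a < i + j
    below-path a a<p with vertex a <? i + j
    ... | yes lt = lt
    ... | no ≮ij = ⊥-elim (<⇒≱ p<K (block-on-cycle C (i + j) K whole))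
      where
      at-offset : i + j + (vertex a ∸ (i + j)) ≡ vertex a
      at-offset = m+[n∸m]≡n (≮⇒≥ ≮ij)
      whole : ∀ t → t < K → OnCycle (i + j + t)
      whole = path-on-cycle (vertex a ∸ (i + j))
        (+-cancelˡ-< (i + j) _ _ (subst (_< i + j + K) (sym at-offset) (bounded a<p)))
        (a , a<p , sym at-offset)

    left-case : vertex 0 < i → p ≡ i
    left-case v₀<i = cycle-in-cycle C-left 1≤i (λ a a<p → z≤n , all-left a a<p)
      where
      stay : ∀ {a} → suc a < p → vertex a < i → vertex (suc a) < i
      stay {a} lt v<i with vertex (suc a) <? i
      ... | yes v'<i = v'<i
      ... | no v'≮i  = ⊥-elim (left-right-apart 1≤K v<i (≮⇒≥ v'≮i) (below-path (suc a) lt) (next lt))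
      all-left : ∀ a → a < p → vertex a < i
      all-left = along C (_< i) v₀<i stay
      C-left : Cycle (i + j + K) (CycleArc 0 i) p
      C-left = restrict C (_< i) all-left (λ u<i v<i → Equivalence.to (left-adj u<i v<i))

    right-case : i ≤ vertex 0 → p ≡ j
    right-case i≤v₀ = cycle-in-cycle C-right 1≤j in-window
      where
      stay : ∀ {a} → suc a < p → i ≤ vertex a → i ≤ vertex (suc a)
      stay {a} lt i≤v with vertex (suc a) <? i
      ... | yes v'<i = ⊥-elim (left-right-apart 1≤K v'<i i≤v (below-path a (<-trans (n<1+n a) lt))
                                 (⊎-swap (next lt)))
      ... | no v'≮i  = ≮⇒≥ v'≮i
      in-window : ∀ a → a < p → i ≤ vertex a × vertex a < i + j
      in-window a a<p = along C (i ≤_) i≤v₀ stay a a<p , below-path a a<p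
      C-right : Cycle (i + j + K) (CycleArc i j) p
      C-right = restrict C (λ v → i ≤ v × v < i + j) in-window
        (λ (i≤u , u<ij) (i≤v , v<ij) → Equivalence.to (right-adj i≤u u<ij i≤v v<ij))

  short-cycle : ∀ {p} → Cycle (i + j + K) Arc p → p < K → p ≡ i ⊎ p ≡ j
  short-cycle C p<K with Cycle.vertex C 0 <? i
  ... | yes v₀<i = inj₁ (ShortCycle.left-case C p<K v₀<i)
  ... | no v₀≮i  = inj₂ (ShortCycle.right-case C p<K (≮⇒≥ v₀≮i))

  left-placement : Placement i K (λ _ → ⊤) (i + j + K) Arc
  left-placement = record
    { κ = λ a → a
    ; τ = λ x → i + j + x
    ; κ-bound = λ a<i → <-≤-trans a<i (≤-trans (m≤m+n i j) (m≤m+n (i + j) K))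
    ; τ-bound = λ x<K _ → +-monoʳ-< (i + j) x<K
    ; κ-inj = λ _ _ e → e
    ; τ-inj = λ _ _ _ _ → internal-cancel
    ; apart = λ a<i _ _ e → internal-far _ e (<-≤-trans a<i (m≤m+n i j))
    ; cycle-adj = left-adj
    ; attach-adj = λ a<i x<K _ → left-path-adj a<i x<K
    ; path-adj = λ x<K y<K _ _ → path-path-adj x<K y<K
    }

  -- D^j_K lies in the butterfly: its cycle on C(i, j), its path along the
  -- internal vertices in reverse, starting next to y = i.
  right-placement : Placement j K (λ _ → ⊤) (i + j + K) Arc
  right-placement = record
    { κ = λ a → i + a
    ; τ = λ x → i + j + (K ∸ suc x)
    ; κ-bound = λ a<j → <-≤-trans (+-monoʳ-< i a<j) (m≤m+n (i + j) K)
    ; τ-bound = λ x<K _ → +-monoʳ-< (i + j) (reflected x<K)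
    ; κ-inj = λ _ _ → +-cancelˡ-≡ i _ _
    ; τ-inj = λ x<K y<K _ _ e → suc-injective (∸-cancelˡ-≡ x<K y<K (internal-cancel e))
    ; apart = λ a<j _ _ e → internal-far _ e (+-monoʳ-< i a<j)
    ; cycle-adj = right-adj-shifted
    ; attach-adj = λ a<j x<K _ → ⇔.trans (right-path-adj a<j (reflected x<K)) (⇔.refl ×-⇔ mirror-end x<K)
    ; path-adj = λ x<K y<K _ _ → ⇔.trans (path-path-adj (reflected x<K) (reflected y<K))
        (⇔.trans (mirror-succ x<K y<K ⊎-⇔ mirror-succ y<K x<K) ⊎-swap-⇔)
    }
    where
    reflected : ∀ {x} → x < K → K ∸ suc x < K
    reflected x<K = ∸-monoʳ-< (s≤s z≤n) x<K

-- Squeezing gaps.  Given P : ℕ → Bool with P 0 true, the map sq keeps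
-- consecutive P-positions consecutive and shrinks every maximal run of
-- positions outside P to a single position.
module Squeeze (P : ℕ → Bool) (P0 : P 0 ≡ true) where

  bump : Bool → ℕ → ℕ
  bump b c = if b then suc c else c

  sq : ℕ → ℕ
  sq zero    = 0
  sq (suc s) = bump (P s ∨ P (suc s)) (sq s)

  sq-step : ∀ s → P s ≡ true → sq (suc s) ≡ suc (sq s)
  sq-step s Ps rewrite Ps = refl

  sq-step′ : ∀ s → P (suc s) ≡ true → sq (suc s) ≡ suc (sq s)
  sq-step′ s Ps′ rewrite Ps′ | ∨-zeroʳ (P s) = refl

  sq-mono : ∀ {s s'} → s ≤ s' → sq s ≤ sq s'
  sq-mono {s} {s'} s≤s' = subst (λ z → sq s ≤ sq z) (m∸n+n≡m s≤s') (grow (s' ∸ s))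
    where
    bump-≤ : ∀ b c → c ≤ bump b c
    bump-≤ true  c = n≤1+n c
    bump-≤ false c = ≤-refl
    grow : ∀ d → sq s ≤ sq (d + s)
    grow zero    = ≤-refl
    grow (suc d) = ≤-trans (grow d) (bump-≤ _ (sq (d + s)))

  sq-strict : ∀ {s s'} → P s' ≡ true → s < s' → sq s < sq s'
  sq-strict {s} {suc s'} Ps' (s≤s s≤s') = subst (sq s <_) (sym (sq-step′ s' Ps')) (s≤s (sq-mono s≤s'))

  sq-gap : ∀ {s s'} → P s ≡ true → P s' ≡ true → suc s < s' → suc (suc (sq s)) ≤ sq s'
  sq-gap {s} Ps Ps' lt = subst (λ z → suc z ≤ _) (sq-step s Ps) (sq-strict Ps' lt)

  sq-inj : ∀ {s s'} → P s ≡ true → P s' ≡ true → sq s ≡ sq s' → s ≡ s'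
  sq-inj {s} {s'} Ps Ps' e with <-cmp s s'
  ... | tri< lt _ _ = ⊥-elim (<⇒≢ (sq-strict Ps' lt) e)
  ... | tri≈ _ eq _ = eq
  ... | tri> _ _ gt = ⊥-elim (<⇒≢ (sq-strict Ps gt) (sym e))

  sq-succ : ∀ {s s'} → P s ≡ true → P s' ≡ true → sq s' ≡ suc (sq s) ⇔ s' ≡ suc s
  sq-succ {s} {s'} Ps Ps' = mk⇔ to from
    where
    to : sq s' ≡ suc (sq s) → s' ≡ suc s
    to e with <-cmp s' (suc s)
    ... | tri< lt _ _ = ⊥-elim (<⇒≱ (subst (sq s <_) (sym e) (n<1+n _)) (sq-mono (s≤s⁻¹ lt)))
    ... | tri≈ _ eq _ = eq
    ... | tri> _ _ gt = ⊥-elim (<-irrefl (sym e) (sq-gap Ps Ps' gt))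
    from : s' ≡ suc s → sq s' ≡ suc (sq s)
    from refl = sq-step s Ps

  sq-bound : (w : ℕ → ℕ) → (∀ s → w s ≤ w (suc s)) → (∀ s → P (suc s) ≡ true → w s < w (suc s)) →
    ∀ s → P s ≡ true → sq s ≤ 2 * w s
  sq-bound w w-mono w-strict s Ps = s≤s⁻¹ (subst (λ b → bump b (sq s) ≤ suc (2 * w s)) Ps (invariant s))
    where
    double : ∀ {v v'} → v < v' → 2 + 2 * v ≤ 2 * v'
    double {v} {v'} lt = subst (_≤ 2 * v') (*-suc 2 v) (*-monoʳ-≤ 2 lt)
    step : ∀ b b' {c v v'} → bump b c ≤ suc (2 * v) → v ≤ v' → (b' ≡ true → v < v') →
      bump b' (bump (b ∨ b') c) ≤ suc (2 * v')
    step true  true  ih _  lt = s≤s (≤-trans ih (≤-trans (n≤1+n _) (double (lt refl))))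
    step true  false ih le _  = ≤-trans ih (s≤s (*-monoʳ-≤ 2 le))
    step false true  ih _  lt = s≤s (≤-trans (s≤s ih) (double (lt refl)))
    step false false ih le _  = ≤-trans ih (s≤s (*-monoʳ-≤ 2 le))
    invariant : ∀ s → bump (P s) (sq s) ≤ suc (2 * w s)
    invariant zero    rewrite P0 = s≤s z≤n
    invariant (suc s) = step (P s) (P (suc s)) (invariant s) (w-mono s) (w-strict s)

sumFin : ∀ {n} → (Fin n → ℕ) → ℕ
sumFin {zero}  g = 0
sumFin {suc n} g = g Fin.zero + sumFin (g ∘ Fin.suc)

sumFin-mono : ∀ {n} {g h : Fin n → ℕ} → (∀ u → g u ≤ h u) → sumFin g ≤ sumFin h
sumFin-mono {zero}  le = z≤n
sumFin-mono {suc n} le = +-mono-≤ (le Fin.zero) (sumFin-mono (le ∘ Fin.suc))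

sumFin-strict : ∀ {n} {g h : Fin n → ℕ} → (∀ u → g u ≤ h u) → ∀ w → g w < h w → sumFin g < sumFin h
sumFin-strict {suc n} le Fin.zero    lt = +-mono-<-≤ lt (sumFin-mono (le ∘ Fin.suc))
sumFin-strict {suc n} le (Fin.suc w) lt = +-mono-≤-< (le Fin.zero) (sumFin-strict (le ∘ Fin.suc) w lt)

sumFin-≤1 : ∀ {n} {g : Fin n → ℕ} → (∀ u → g u ≤ 1) → sumFin g ≤ n
sumFin-≤1 {zero}  le = z≤n
sumFin-≤1 {suc n} le = +-mono-≤ (le Fin.zero) (sumFin-≤1 (le ∘ Fin.suc))

indicator : ∀ {A : Set} → Dec A → ℕ
indicator (yes _) = 1
indicator (no _)  = 0

indicator-≤1 : ∀ {A : Set} (d : Dec A) → indicator d ≤ 1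
indicator-≤1 (yes _) = ≤-refl
indicator-≤1 (no _)  = z≤n

indicator-mono : ∀ {A B : Set} → (A → B) → (d : Dec A) (d' : Dec B) → indicator d ≤ indicator d'
indicator-mono _   (no _)  _        = z≤n
indicator-mono _   (yes _) (yes _)  = ≤-refl
indicator-mono A→B (yes a) (no ¬b)  = ⊥-elim (¬b (A→B a))

indicator-strict : ∀ {A B : Set} → ¬ A → B → (d : Dec A) (d' : Dec B) → indicator d < indicator d'
indicator-strict ¬a _ (yes a) _       = ⊥-elim (¬a a)
indicator-strict _  _ (no _)  (yes _) = ≤-refl
indicator-strict _  b (no _)  (no ¬b) = ⊥-elim (¬b b)

suc-pred-pos : ∀ {n} → 1 ≤ n → suc (pred n) ≡ n
suc-pred-pos (s≤s _) = refl

-- The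
-- path vertices used by G are squeezed towards the cycle; this keeps the
-- attachment and all (non-)adjacencies, and each used path vertex accounts
-- for at most two positions of the squeezed path.
module Compression {p k : ℕ} {G : RawGraph} (1≤p : 1 ≤ p) (emb : InducedIn G (D p k)) where
  order : ℕ
  order = size G

  f : Fin order → Fin (p + k)
  f = proj₁ emb

  -- Position 0 is the cycle vertex 0; position x+1 is the path vertex p + x,
  -- present when it is the image of a vertex of G.
  present : ℕ → Bool
  present zero    = true
  present (suc x) = does (Finₚ.any? λ u → toℕ (f u) ≟ p + x)

  Present : ℕ → Set
  Present x = present (suc x) ≡ true

  present-intro : ∀ u x → toℕ (f u) ≡ p + x → Present x
  present-intro u x e with Finₚ.any? (λ u → toℕ (f u) ≟ p + x)
  ... | yes _  = refl
  ... | no ¬∃  = ⊥-elim (¬∃ (u , e))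

  present-elim : ∀ x → Present x → Σ (Fin order) λ u → toℕ (f u) ≡ p + x
  present-elim x e with Finₚ.any? (λ u → toℕ (f u) ≟ p + x)
  present-elim x e  | yes w = w
  present-elim x () | no _

  open Squeeze present refl

  slot : ℕ → ℕ
  slot x = pred (sq (suc x))

  sq-slot : ∀ x → sq (suc x) ≡ suc (slot x)
  sq-slot x = sym (suc-pred-pos (sq-mono {1} {suc x} (s≤s z≤n)))

  count : ℕ → ℕ
  count s = sumFin λ u → indicator (toℕ (f u) <? p + s)

  count-mono : ∀ s → count s ≤ count (suc s)
  count-mono s = sumFin-mono λ u →
    indicator-mono (λ lt → <-≤-trans lt (+-monoʳ-≤ p (n≤1+n s))) (toℕ (f u) <? p + s) _

  count-strict : ∀ s → Present s → count s < count (suc s)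
  count-strict s Ps with present-elim s Ps
  ... | u , e = sumFin-strict (λ u → indicator-mono (λ lt → <-≤-trans lt (+-monoʳ-≤ p (n≤1+n s))) _ _) u
      -- the vertex u at label p + s is counted at s + 1 but not at s
      (indicator-strict (λ lt → <-irrefl e lt) (subst (_< p + suc s) (sym e) (+-monoʳ-< p (n<1+n s))) _ _)

  slot-bound : ∀ {x} → Present x → slot x < 2 * order
  slot-bound {x} Px = subst (_≤ 2 * order) (sq-slot x)
    (≤-trans (sq-bound count count-mono count-strict (suc x) Px)
             (*-monoʳ-≤ 2 (sumFin-≤1 λ u → indicator-≤1 (toℕ (f u) <? p + suc x))))

  slot-inj : ∀ {x y} → Present x → Present y → slot x ≡ slot y → x ≡ y
  slot-inj {x} {y} Px Py e = suc-injective (sq-inj Px Py (begin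
    sq (suc x)    ≡⟨ sq-slot x ⟩
    suc (slot x)  ≡⟨ cong suc e ⟩
    suc (slot y)  ≡⟨ sq-slot y ⟨
    sq (suc y)    ∎))
    where open ≡-Reasoning

  slot-zero : ∀ {x} → Present x → slot x ≡ 0 ⇔ x ≡ 0
  slot-zero {x} Px = mk⇔ to from
    where
    to : slot x ≡ 0 → x ≡ 0
    to e = suc-injective (Equivalence.to (sq-succ {0} refl Px) (trans (sq-slot x) (cong suc e)))
    from : x ≡ 0 → slot x ≡ 0
    from refl = refl

  slot-succ : ∀ {x y} → Present x → Present y → slot y ≡ suc (slot x) ⇔ y ≡ suc x
  slot-succ {x} {y} Px Py = mk⇔ to from
    where
    to : slot y ≡ suc (slot x) → y ≡ suc x
    to e = suc-injective (Equivalence.to (sq-succ Px Py) (begin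
      sq (suc y)          ≡⟨ sq-slot y ⟩
      suc (slot y)        ≡⟨ cong suc e ⟩
      suc (suc (slot x))  ≡⟨ cong suc (sq-slot x) ⟨
      suc (sq (suc x))    ∎))
      where open ≡-Reasoning
    from : y ≡ suc x → slot y ≡ suc (slot x)
    from e = suc-injective (begin
      suc (slot y)        ≡⟨ sq-slot y ⟨
      sq (suc y)          ≡⟨ Equivalence.from (sq-succ Px Py) (cong suc e) ⟩
      suc (sq (suc x))    ≡⟨ cong suc (sq-slot x) ⟩
      suc (suc (slot x))  ∎)
      where open ≡-Reasoning

  module T = Tadpole p (2 * order) 1≤p

  placement : Placement p k Present (p + 2 * order) T.Arc
  placement = record
    { κ = λ a → a
    ; τ = λ x → p + slot x
    ; κ-bound = λ a<p → <-≤-trans a<p (m≤m+n p _)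
    ; τ-bound = λ _ Px → +-monoʳ-< p (slot-bound Px)
    ; κ-inj = λ _ _ e → e
    ; τ-inj = λ _ _ Px Py e → slot-inj Px Py (+-cancelˡ-≡ p _ _ e)
    ; apart = λ {_} {x} a<p _ _ → T.path-far (slot x) a<p
    ; cycle-adj = T.cycle-adj
    ; attach-adj = λ a<p _ Px → ⇔.trans (T.attach-adj a<p (slot-bound Px)) (⇔.refl ×-⇔ slot-zero Px)
    ; path-adj = λ _ _ Px Py →
        ⇔.trans (T.path-adj (slot-bound Px) (slot-bound Py)) (slot-succ Px Py ⊎-⇔ slot-succ Py Px)
    }

  compress : InducedIn G (D p (2 * order))
  compress = placement-embeds 1≤p placement emb present-intro

-- B_{i,j,N} for N = 2|G| + 1 is B i j (suc K) with K = 2|G|.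
cover-length : ∀ n → suc (2 * n) ≡ 2 * n + 1
cover-length n = +-comm 1 (2 * n)

tadpole-covers : ∀ {p k} (G : Graph) → 3 ≤ p → InducedIn (toRaw G) (D p k) →
  ∀ i j → 3 ≤ i → 3 ≤ j → (i ≡ p ⊎ j ≡ p) → Covers G i j
tadpole-covers {p} G 3≤p emb i j 3≤i 3≤j p∈ij =
  subst (λ N → InducedIn (toRaw G) (B i j N)) (cover-length (n G))
    (induced-trans {G = D p K} {H = B i j (suc K)}
      (Compression.compress 1≤p emb) (into-butterfly p∈ij))
  where
  K : ℕ
  K = 2 * n G
  1≤p : 1 ≤ p
  1≤p = ≤-trans (s≤s z≤n) 3≤p
  open Butterfly i j K (≤-trans (s≤s z≤n) 3≤i) (≤-trans (s≤s z≤n) 3≤j)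
  into-butterfly : (i ≡ p ⊎ j ≡ p) → InducedIn (D p K) (B i j (suc K))
  into-butterfly (inj₁ refl) = placement-embeds 1≤p left-placement induced-refl (λ _ _ _ → _)
  into-butterfly (inj₂ refl) = placement-embeds 1≤p right-placement induced-refl (λ _ _ _ → _)

covering-tadpole : ∀ {p k} (H : Graph) → 3 ≤ p → InducedIn (D p k) (toRaw H) →
  ∀ i j → 3 ≤ i → 3 ≤ j → Covers H i j → i ≡ p ⊎ j ≡ p
covering-tadpole {p} {k} H 3≤p emb i j 3≤i 3≤j cover =
  ⊎-map sym sym (short-cycle (Tadpole.cycle-of p k 1≤p 3≤p D⊆B) p<K)
  where
  K : ℕ
  K = 2 * n H
  1≤p : 1 ≤ p
  1≤p = ≤-trans (s≤s z≤n) 3≤p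
  open Butterfly i j K (≤-trans (s≤s z≤n) 3≤i) (≤-trans (s≤s z≤n) 3≤j)
  cover′ : InducedIn (toRaw H) (B i j (suc K))
  cover′ = subst (λ N → InducedIn (toRaw H) (B i j N)) (sym (cover-length (n H))) cover
  D⊆B : InducedIn (D p k) (B i j (suc K))
  D⊆B = induced-trans {G = toRaw H} {H = B i j (suc K)} emb cover′
  p≤|H| : p ≤ n H
  p≤|H| = ≤-trans (m≤m+n p k) (Finₚ.injective⇒≤ (proj₁ (proj₂ emb)))
  p<K : p < K
  p<K = <-≤-trans (m<m+n p (≤-trans 1≤p (m≤m+n p 0))) (*-monoʳ-≤ 2 p≤|H|)

lemma1 : (p : ℕ) → 3 ≤ p →
    ((H : Graph) → (∃ λ k → InducedIn (toRaw H) (D p k)) →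
      ∀ i j → 3 ≤ i → 3 ≤ j → (i ≡ p ⊎ j ≡ p) → Covers H i j)
    × ((H : Graph) → (∃ λ k → InducedIn (D p k) (toRaw H)) →
      ∀ i j → 3 ≤ i → 3 ≤ j → ¬ (i ≡ p ⊎ j ≡ p) → ¬ Covers H i j)
lemma1 p 3≤p =
  (λ H (_ , emb) → tadpole-covers H 3≤p emb) ,
  (λ H (_ , emb) i j 3≤i 3≤j p∉ij cover → p∉ij (covering-tadpole H 3≤p emb i j 3≤i 3≤j cover))
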